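{- Let $G$ and $H$ be cographs, assume $G$ is connected and that $G$ retracts to $H$. Then $H$ is connected. Moreover, let $G_1,\dots,G_t$ be the subgraphs of $G$ induced by the cocomponents of $G$. Then there is a partition of the set of cocomponents of $H$ into $t$ parts such that the subgraphs of $H$ induced by the unions of the parts can be ordered $H_1,\dots,H_t$ so that $G_i$ retracts to $H_i$ for every $i\in\{1,\dots,t\}$.
   Context: All graphs are finite and simple. A cograph is a graph with no induced subgraph isomorphic to $P_4$, the path on four vertices. A cocomponent of a graph $G$ is a vertex set inducing a connected component of the complement $\bar{G}$. A homomorphism $\phi: G\to H$ is a map $V(G)\to V(H)$ such that $\{x,y\}\in E(G)$ implies $\{\phi(x),\phi(y)\}\in E(H)$. The graph $H$ is a retract of $G$ (equivalently, $G$ retracts to $H$) if there exist homomorphisms $\rho: G\to H$ and $\gamma: H\to G$ with $\rho\circ\gamma=\mathrm{id}_{V(H)}$. -}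

module Defs where

open import Data.Nat using (ℕ)
open import Data.Fin using (Fin)
open import Data.Bool using (Bool; true; false; T)
open import Data.Product using (Σ; ∃; ∃-syntax; _×_; _,_; proj₁)
open import Data.Empty using (⊥)
open import Relation.Nullary using (¬_)
open import Relation.Binary.PropositionalEquality using (_≡_; _≢_)
open import Relation.Binary.Construct.Closure.ReflexiveTransitive using (Star)
open import Function.Bundles using (_↔_; _⇔_)

record Graph : Set₁ where
  field
    V         : Set
    adj       : V → V → Bool
    adj-sym   : ∀ x y → adj x y ≡ adj y x
    adj-irr   : ∀ x → adj x x ≡ false

open Graph public

Edge : (G : Graph) → V G → V G → Set
Edge G x y = T (adj G x y)

CoEdge : (G : Graph) → V G → V G → Set
CoEdge G x y = (x ≢ y) × (adj G x y ≡ false)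

Finite : Graph → Set
Finite G = ∃[ n ] (V G ↔ Fin n)

Connected : Graph → Set
Connected G = V G × (∀ x y → Star (Edge G) x y)

InducedP4 : (G : Graph) → V G → V G → V G → V G → Set
InducedP4 G a b c d =
  Edge G a b × Edge G b c × Edge G c d ×
  adj G a c ≡ false × adj G b d ≡ false × adj G a d ≡ false ×
  a ≢ c × b ≢ d × a ≢ d

Cograph : Graph → Set
Cograph G = ¬ (Σ (V G) λ a → Σ (V G) λ b → Σ (V G) λ c → Σ (V G) λ d → InducedP4 G a b c d)

Induced : (G : Graph) → (V G → Set) → Graph
Induced G P = record
  { V       = Σ (V G) P
  ; adj     = λ x y → adj G (proj₁ x) (proj₁ y)
  ; adj-sym = λ x y → adj-sym G (proj₁ x) (proj₁ y)
  ; adj-irr = λ x → adj-irr G (proj₁ x)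
  }

IsHom : (G H : Graph) → (V G → V H) → Set
IsHom G H f = ∀ x y → Edge G x y → Edge H (f x) (f y)

Retracts : Graph → Graph → Set
Retracts G H =
  Σ (V G → V H) λ ρ → Σ (V H → V G) λ γ →
    IsHom G H ρ × IsHom H G γ × (∀ y → ρ (γ y) ≡ y)

Surj : {A B : Set} → (A → B) → Set
Surj {A} {B} f = ∀ b → ∃[ a ] (f a ≡ b)

-- c labels the cocomponents of G by Fin t: every label is used, and two vertices
-- get the same label iff they are in the same connected component of the complement.
CocompLabeling : (G : Graph) (t : ℕ) → (V G → Fin t) → Set
CocompLabeling G t c = Surj c × (∀ x y → (c x ≡ c y) ⇔ Star (CoEdge G) x y)

module Submission where

-- * Connectivity: ρ maps walks to walks and is surjective, so H inherits
--   connectivity from G.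
-- * Cocomponents: γ maps non-edges of H to non-edges of G (an edge γy γy'
--   would give the edge ργy ργy' = y y'), so γ maps each cocomponent of H
--   into a cocomponent of G.  This defines p : cocomponents(H) → cocomponents(G).
--   Vertices in different cocomponents are adjacent, so x and γ(ρ x) share a
--   cocomponent (otherwise ρ x would carry a loop).  Hence ρ maps the
--   cocomponent G_i into H_i = ⋃ p⁻¹(i), γ maps H_i into G_i, and p is onto.
--   Restricting ρ and γ gives the retractions G_i → H_i.

open import Defs
open import Data.Nat using (ℕ)
open import Data.Fin using (Fin)
import Data.Fin.Properties as Fin
open import Data.Product using (Σ; _×_; _,_; proj₁; proj₂)
open import Data.Bool using (true; false)
open import Data.Unit using (tt)
open import Data.Empty using (⊥-elim)
open import Relation.Nullary using (¬_; yes; no)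
open import Relation.Binary.PropositionalEquality
  using (_≡_; _≢_; refl; sym; trans; cong; subst₂)
open import Relation.Binary.Construct.Closure.ReflexiveTransitive using (Star; ε; _◅_; gmap)
open import Function.Bundles using (Equivalence)
open import Axiom.UniquenessOfIdentityProofs using (module Decidable⇒UIP)

edge-of-true : (G : Graph) → ∀ x y → adj G x y ≡ true → Edge G x y
edge-of-true G x y e rewrite e = tt

no-loop : (G : Graph) → ∀ x → ¬ Edge G x x
no-loop G x e rewrite adj-irr G x = e

hom-walk : (G H : Graph) (f : V G → V H) → IsHom G H f →
           ∀ {x y} → Star (Edge G) x y → Star (Edge H) (f x) (f y)
hom-walk G H f hom = gmap f (λ {a} {b} → hom a b)

-- A retract of a connected graph is connected: a walk from γ y to γ y' in G
-- maps under ρ to a walk from y to y' in H.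
retract-connected : (G H : Graph) → Retracts G H → Connected G → Connected H
retract-connected G H (ρ , γ , hom-ρ , _ , ρ∘γ) (x₀ , walks) =
  ρ x₀ , λ y y' → subst₂ (Star (Edge H)) (ρ∘γ y) (ρ∘γ y')
                     (hom-walk G H ρ hom-ρ (walks (γ y) (γ y')))

module Section (G H : Graph) (ρ : V G → V H) (γ : V H → V G)
               (hom-ρ : IsHom G H ρ) (ρ∘γ : ∀ y → ρ (γ y) ≡ y) where

  γ-injective : ∀ y y' → γ y ≡ γ y' → y ≡ y'
  γ-injective y y' eq = trans (sym (ρ∘γ y)) (trans (cong ρ eq) (ρ∘γ y'))

  -- γ reflects edges: an edge γ y γ y' would be mapped by ρ to an edge y y'.
  γ-nonadjacent : ∀ y y' → adj H y y' ≡ false → adj G (γ y) (γ y') ≡ false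
  γ-nonadjacent y y' non with adj G (γ y) (γ y') in e
  ... | false = refl
  ... | true with hom-ρ (γ y) (γ y') (edge-of-true G _ _ e)
  ...   | edge rewrite ρ∘γ y | ρ∘γ y' | non = ⊥-elim edge

  γ-cowalk : ∀ {y y'} → Star (CoEdge H) y y' → Star (CoEdge G) (γ y) (γ y')
  γ-cowalk = gmap γ (λ {y} {y'} (y≢y' , non) →
                      (λ eq → y≢y' (γ-injective y y' eq)) , γ-nonadjacent y y' non)

module Labeling (G : Graph) {t : ℕ} (c : V G → Fin t) (lab : CocompLabeling G t c) where

  same-label : ∀ x y → Star (CoEdge G) x y → c x ≡ c y
  same-label x y = Equivalence.from (proj₂ lab x y)

  co-walk : ∀ x y → c x ≡ c y → Star (CoEdge G) x y
  co-walk x y = Equivalence.to (proj₂ lab x y)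

  -- Vertices in different cocomponents are adjacent (a non-edge would be a co-edge).
  distinct-labels-adjacent : ∀ x y → c x ≢ c y → adj G x y ≡ true
  distinct-labels-adjacent x y c≢ with adj G x y in e
  ... | true = refl
  ... | false = ⊥-elim (c≢ (same-label x y (((λ x≡y → c≢ (cong c x≡y)) , e) ◅ ε)))

-- Two elements of a fibre { a | f a ≡ i } of a map into Fin n are equal as soon
-- as their underlying elements are (equality proofs in Fin n are unique).
fibre-≡ : {A : Set} {n : ℕ} {f : A → Fin n} {i : Fin n} {a b : A} → a ≡ b →
          (ea : f a ≡ i) (eb : f b ≡ i) →
          _≡_ {A = Σ A (λ z → f z ≡ i)} (a , ea) (b , eb)
fibre-≡ refl ea eb = cong (_ ,_) (Decidable⇒UIP.≡-irrelevant Fin._≟_ ea eb)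

restrict-retraction : (G H : Graph) {t : ℕ} (cG : V G → Fin t) (cH : V H → Fin t) →
  (ρ : V G → V H) (γ : V H → V G) → IsHom G H ρ → IsHom H G γ → (∀ y → ρ (γ y) ≡ y) →
  (∀ x → cH (ρ x) ≡ cG x) → (∀ y → cG (γ y) ≡ cH y) →
  (i : Fin t) → Retracts (Induced G (λ x → cG x ≡ i)) (Induced H (λ y → cH y ≡ i))
restrict-retraction G H cG cH ρ γ hom-ρ hom-γ ρ∘γ ρ-labels γ-labels i =
    (λ (x , e) → ρ x , trans (ρ-labels x) e)
  , (λ (y , e) → γ y , trans (γ-labels y) e)
  , (λ (x , _) (x' , _) → hom-ρ x x')
  , (λ (y , _) (y' , _) → hom-γ y y')
  , (λ (y , e) → fibre-≡ (ρ∘γ y) _ e)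

mainTheorem8 : (G H : Graph) → Finite G → Finite H → Cograph G → Cograph H →
    Connected G → Retracts G H →
    Connected H ×
    ((t : ℕ) (cG : V G → Fin t) → CocompLabeling G t cG →
    (s : ℕ) (cH : V H → Fin s) → CocompLabeling H s cH →
    Σ (Fin s → Fin t) λ p → Surj p ×
    ((i : Fin t) → Retracts (Induced G (λ x → cG x ≡ i)) (Induced H (λ y → p (cH y) ≡ i))))
mainTheorem8 G H _ _ _ _ connG retr@(ρ , γ , hom-ρ , hom-γ , ρ∘γ) =
  retract-connected G H retr connG , partition
  where
  open Section G H ρ γ hom-ρ ρ∘γ

  partition : (t : ℕ) (cG : V G → Fin t) → CocompLabeling G t cG →
              (s : ℕ) (cH : V H → Fin s) → CocompLabeling H s cH →
              Σ (Fin s → Fin t) λ p → Surj p ×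
              ((i : Fin t) → Retracts (Induced G (λ x → cG x ≡ i))
                                      (Induced H (λ y → p (cH y) ≡ i)))
  partition t cG labG s cH labH@(surjH , _) = p , p-onto ,
      restrict-retraction G H cG (λ y → p (cH y)) ρ γ hom-ρ hom-γ ρ∘γ ρ-labels (λ y → sym (p-γ y))
    where
    open Labeling G cG labG
    module LH = Labeling H cH labH

    p : Fin s → Fin t
    p j = cG (γ (proj₁ (surjH j)))

    -- Well defined: γ maps a whole cocomponent of H into one cocomponent of G.
    p-γ : ∀ y → p (cH y) ≡ cG (γ y)
    p-γ y = same-label _ _ (γ-cowalk (LH.co-walk _ y (proj₂ (surjH (cH y)))))

    -- x and γ (ρ x) share a cocomponent, else ρ x would be a looped vertex.
    γρ-label : ∀ x → cG (γ (ρ x)) ≡ cG x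
    γρ-label x with cG (γ (ρ x)) Fin.≟ cG x
    ... | yes eq = eq
    ... | no neq with hom-ρ x (γ (ρ x))
                        (edge-of-true G _ _ (distinct-labels-adjacent x _ (λ eq → neq (sym eq))))
    ...   | edge rewrite ρ∘γ (ρ x) = ⊥-elim (no-loop H (ρ x) edge)

    ρ-labels : ∀ x → p (cH (ρ x)) ≡ cG x
    ρ-labels x = trans (p-γ (ρ x)) (γρ-label x)

    p-onto : Surj p
    p-onto i with proj₁ labG i
    ... | x , e = cH (ρ x) , trans (ρ-labels x) e
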